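{- Let $\Delta$ be a weak tropical surface. Then the degree of its second Todd class $\operatorname{td}_2(\Delta)$ equals the topological Euler characteristic $\chi(\Delta)$.
   Context: A weak tropical surface is a finite, connected $\Delta$-complex $\Delta$ (in the sense of Hatcher) all of whose cells have dimension at most $2$ (vertices, edges, facets), together with an integer $\alpha(v,e)$ for every edge $e$ and every endpoint $v$ of $e$ (endpoints taken before identifications), such that for each edge $e$ with endpoints $v,w$, $\alpha(v,e)+\alpha(w,e)=\deg(e)$, the number of pairs (facet $f$, edge of $f$ identified with $e$). The link $\operatorname{link}_\Delta(v)$ of a vertex $v$ is the graph whose vertices are the pairs (edge $e$, endpoint of $e$ identified with $v$) and whose edges are the pairs (facet $f$, vertex of $f$ identified with $v$). The second Todd class is the formal combination of vertices $\operatorname{td}_2(\Delta)=\frac{1}{12}\sum_{v}\big(12+5F_v-6E_v-\sum_{e}\alpha(v,e)\big)[v]$, where $F_v$ and $E_v$ are the numbers of edges and of vertices of $\operatorname{link}_\Delta(v)$, and the inner sum is over the vertices of $\operatorname{link}_\Delta(v)$, each corresponding to an edge $e$ with an endpoint identified with $v$ (the term is $\alpha$ of that endpoint). Its degree is the sum of its coefficients. -}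

module Defs where

open import Data.Nat using (ℕ; zero; suc; _<_)
open import Data.Fin using (Fin; zero; suc; _≟_)
open import Data.Integer as ℤ using (ℤ; +_)
open import Data.Rational as ℚ using (ℚ)
open import Data.Product using (Σ; _×_; _,_; ∃-syntax)
open import Data.Sum using (_⊎_)
open import Relation.Nullary using (Dec; yes; no)
open import Relation.Binary.PropositionalEquality using (_≡_)
open import Relation.Binary.Construct.Closure.ReflexiveTransitive using (Star)

sumℕ : (n : ℕ) → (Fin n → ℕ) → ℕ
sumℕ zero    f = 0
sumℕ (suc n) f = f zero Data.Nat.+ sumℕ n (λ i → f (suc i))

sumℤ : (n : ℕ) → (Fin n → ℤ) → ℤ
sumℤ zero    f = + 0
sumℤ (suc n) f = f zero ℤ.+ sumℤ n (λ i → f (suc i))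

sumℚ : (n : ℕ) → (Fin n → ℚ) → ℚ
sumℚ zero    f = ℚ.0ℚ
sumℚ (suc n) f = f zero ℚ.+ sumℚ n (λ i → f (suc i))

ind : ∀ {P : Set} → Dec P → ℕ
ind (yes _) = 1
ind (no _)  = 0

-- A finite Δ-complex (Hatcher) with cells of dimension ≤ 2.
-- Vertices Fin nV, edges Fin nE, facets (2-simplices) Fin nF.
-- ep e i : the image of vertex i (i = 0,1) of the standard 1-simplex of e.
-- bd f j : the edge of f opposite to its vertex j (j = 0,1,2), i.e. the face
--          map d_j; the edge [v0,v1,v2] ∖ vj with the induced vertex order.
-- Simplicial identities: d_i d_j = d_{j-1} d_i for i < j.
record DeltaComplex2 : Set where
  field
    nV nE nF : ℕ
    ep : Fin nE → Fin 2 → Fin nV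
    bd : Fin nF → Fin 3 → Fin nE
    -- vertex v0 of f: vertex 0 of edge [v0,v1] (=bd f 2) and of edge [v0,v2] (=bd f 1)
    id-v0 : ∀ f → ep (bd f (suc (suc zero))) zero ≡ ep (bd f (suc zero)) zero
    -- vertex v1: vertex 1 of [v0,v1] and vertex 0 of [v1,v2] (=bd f 0)
    id-v1 : ∀ f → ep (bd f (suc (suc zero))) (suc zero) ≡ ep (bd f zero) zero
    -- vertex v2: vertex 1 of [v0,v2] and vertex 1 of [v1,v2]
    id-v2 : ∀ f → ep (bd f (suc zero)) (suc zero) ≡ ep (bd f zero) (suc zero)

module _ (Δ : DeltaComplex2) where
  open DeltaComplex2 Δ

  facetVertex : Fin nF → Fin 3 → Fin nV
  facetVertex f zero             = ep (bd f (suc (suc zero))) zero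
  facetVertex f (suc zero)       = ep (bd f (suc (suc zero))) (suc zero)
  facetVertex f (suc (suc zero)) = ep (bd f (suc zero)) (suc zero)

  deg : Fin nE → ℕ
  deg e = sumℕ nF (λ f → sumℕ 3 (λ j → ind (bd f j ≟ e)))

  linkVertices : Fin nV → ℕ
  linkVertices v = sumℕ nE (λ e → sumℕ 2 (λ i → ind (ep e i ≟ v)))

  linkEdges : Fin nV → ℕ
  linkEdges v = sumℕ nF (λ f → sumℕ 3 (λ k → ind (facetVertex f k ≟ v)))

  Adj : Fin nV → Fin nV → Set
  Adj v w = ∃[ e ] ((ep e zero ≡ v × ep e (suc zero) ≡ w) ⊎ (ep e zero ≡ w × ep e (suc zero) ≡ v))

  -- connectedness (of the geometric realization, equivalently of the 1-skeleton)
  Connected : Set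
  Connected = (0 < nV) × (∀ v w → Star Adj v w)

  euler : ℤ
  euler = (+ nV ℤ.- + nE) ℤ.+ + nF

record WeakTropicalSurface : Set where
  field
    complex   : DeltaComplex2
  open DeltaComplex2 complex
  field
    connected : Connected complex
    α         : Fin nE → Fin 2 → ℤ
    α-deg     : ∀ e → α e zero ℤ.+ α e (suc zero) ≡ + deg complex e

module _ (S : WeakTropicalSurface) where
  open WeakTropicalSurface S
  open DeltaComplex2 complex

  αSum : Fin nV → ℤ
  αSum v = sumℤ nE (λ e → sumℤ 2 (λ i → ℤ._*_ (+ ind (ep e i ≟ v)) (α e i)))

  -- coefficient of [v] in td₂(Δ)
  td2 : Fin nV → ℚ
  td2 v = (((+ 12 ℤ.+ + 5 ℤ.* + linkEdges complex v) ℤ.- + 6 ℤ.* + linkVertices complex v) ℤ.- αSum v) ℚ./ 12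

  degTd2 : ℚ
  degTd2 = sumℚ nV td2

  χ : ℚ
  χ = euler complex ℚ./ 1

module Submission where

-- Multiply td₂ by 12; its degree becomes the integer
--   Σ_v (12 + 5·F_v − 6·E_v − Σ_{e∋v} α(v,e)),
-- and each of the three vertex-indexed sums is evaluated by double counting
-- incidences:  Σ_v F_v = 3·#facets (every facet has three corners),
-- Σ_v E_v = 2·#edges (every edge has two endpoints), and
-- Σ_v Σ_{e∋v} α(v,e) = Σ_e (α(e,0) + α(e,1)) = Σ_e deg e = 3·#facets
-- (every facet has three sides).  Hence the total is
--   12·V + 15·F − 12·E − 3·F = 12·(V − E + F) = 12·χ(Δ).

open import Defs
open import Data.Nat using (ℕ; zero; suc)
open import Data.Fin using (Fin; zero; suc; _≟_)
open import Data.Fin.Properties using (suc-injective)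
open import Data.Integer as ℤ using (ℤ; +_)
open import Data.Integer.Properties as ℤP using (+-*-semiring)
open import Data.Integer.Tactic.RingSolver using (solve-∀)
open import Data.Rational as ℚ using ()
open import Data.Rational.Properties using (fromℚᵘ-toℚᵘ; fromℚᵘ-cong; toℚᵘ-fromℚᵘ; toℚᵘ-homo-+)
open import Data.Rational.Unnormalised using (mkℚᵘ; *≡*)
open import Data.Rational.Unnormalised.Properties as ℚᵘP using (≃-trans)
open import Algebra.Properties.Semiring.Sum +-*-semiring
  using (sum-syntax; sum-cong-≗; ∑-distrib-+; ∑-comm; *-distribˡ-sum)
open import Relation.Nullary using (Dec; yes; no; ¬_)
open import Data.Empty using (⊥-elim)
open import Relation.Binary.PropositionalEquality
  using (_≡_; refl; sym; trans; cong; cong₂; module ≡-Reasoning)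

ind-⇔ : ∀ {P Q : Set} → (P → Q) → (Q → P) → (p : Dec P) (q : Dec Q) → ind p ≡ ind q
ind-⇔ _ _ (yes _) (yes _) = refl
ind-⇔ _ _ (no _)  (no _)  = refl
ind-⇔ P→Q _   (yes p) (no ¬q) = ⊥-elim (¬q (P→Q p))
ind-⇔ _   Q→P (no ¬p) (yes q) = ⊥-elim (¬p (Q→P q))

ind-yes : ∀ {P : Set} → P → (p : Dec P) → ind p ≡ 1
ind-yes _ (yes _) = refl
ind-yes x (no ¬x) = ⊥-elim (¬x x)

ind-no : ∀ {P : Set} → ¬ P → (p : Dec P) → ind p ≡ 0
ind-no ¬x (yes x) = ⊥-elim (¬x x)
ind-no _  (no _)  = refl

sumℤ≡∑ : ∀ n (f : Fin n → ℤ) → sumℤ n f ≡ ∑[ i < n ] f i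
sumℤ≡∑ zero    f = refl
sumℤ≡∑ (suc n) f = cong (λ s → f zero ℤ.+ s) (sumℤ≡∑ n (λ i → f (suc i)))

sumℕ≡∑ : ∀ n (f : Fin n → ℕ) → + sumℕ n f ≡ ∑[ i < n ] (+ f i)
sumℕ≡∑ zero    f = refl
sumℕ≡∑ (suc n) f =
  trans (ℤP.pos-+ (f zero) _) (cong (λ s → + f zero ℤ.+ s) (sumℕ≡∑ n (λ i → f (suc i))))

∑-const : ∀ n c → ∑[ i < n ] c ≡ + n ℤ.* c
∑-const zero    c = sym (ℤP.*-zeroˡ c)
∑-const (suc n) c = trans (cong (λ s → c ℤ.+ s) (∑-const n c)) (collect c (+ n))
  where
  collect : ∀ c n → c ℤ.+ n ℤ.* c ≡ (+ 1 ℤ.+ n) ℤ.* c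
  collect = solve-∀

∑-affine : ∀ n c p q (x y z : Fin n → ℤ) →
  ∑[ v < n ] (((c ℤ.+ p ℤ.* x v) ℤ.- q ℤ.* y v) ℤ.- z v)
    ≡ ((+ n ℤ.* c ℤ.+ p ℤ.* ∑[ v < n ] x v) ℤ.- q ℤ.* ∑[ v < n ] y v) ℤ.- ∑[ v < n ] z v
∑-affine n c p q x y z = begin
    ∑[ v < n ] (((c ℤ.+ p ℤ.* x v) ℤ.- q ℤ.* y v) ℤ.- z v)
  ≡⟨ ∑-distrib-+ {n} _ _ ⟩
    ∑[ v < n ] ((c ℤ.+ p ℤ.* x v) ℤ.- q ℤ.* y v) ℤ.+ ∑[ v < n ] (ℤ.- z v)
  ≡⟨ cong₂ ℤ._+_ (∑-distrib-+ {n} _ _) (∑-neg z) ⟩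
    (∑[ v < n ] (c ℤ.+ p ℤ.* x v) ℤ.+ ∑[ v < n ] (ℤ.- (q ℤ.* y v))) ℤ.- ∑[ v < n ] z v
  ≡⟨ cong (ℤ._- ∑[ v < n ] z v) (cong₂ ℤ._+_
       (trans (∑-distrib-+ {n} _ _) (cong₂ ℤ._+_ (∑-const n c) (sym (*-distribˡ-sum p x))))
       (trans (∑-neg _) (cong ℤ.-_ (sym (*-distribˡ-sum q y))))) ⟩
    ((+ n ℤ.* c ℤ.+ p ℤ.* ∑[ v < n ] x v) ℤ.- q ℤ.* ∑[ v < n ] y v) ℤ.- ∑[ v < n ] z v
  ∎
  where
  open ≡-Reasoning
  ∑-neg : ∀ (f : Fin n → ℤ) → ∑[ v < n ] (ℤ.- f v) ≡ ℤ.- ∑[ v < n ] f v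
  ∑-neg f = begin
      ∑[ v < n ] (ℤ.- f v)         ≡⟨ sum-cong-≗ {n} (λ v → sym (ℤP.-1*i≡-i (f v))) ⟩
      ∑[ v < n ] (ℤ.-1ℤ ℤ.* f v)   ≡⟨ sym (*-distribˡ-sum ℤ.-1ℤ f) ⟩
      ℤ.-1ℤ ℤ.* ∑[ v < n ] f v     ≡⟨ ℤP.-1*i≡-i _ ⟩
      ℤ.- ∑[ v < n ] f v           ∎

∑-delta : ∀ n (x : Fin n) a → ∑[ v < n ] (+ ind (x ≟ v) ℤ.* a) ≡ a
∑-delta (suc n) zero a = begin
    + ind (zero {n} ≟ zero) ℤ.* a ℤ.+ ∑[ v < n ] (+ ind (zero ≟ suc v) ℤ.* a)
  ≡⟨ cong₂ ℤ._+_ (cong (λ k → + k ℤ.* a) (ind-yes refl (zero {n} ≟ zero)))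
                 (sum-cong-≗ {n} (λ v → trans (cong (λ k → + k ℤ.* a) (ind-no (λ ()) (zero ≟ suc v)))
                                          (ℤP.*-zeroˡ a))) ⟩
    + 1 ℤ.* a ℤ.+ ∑[ v < n ] (+ 0)
  ≡⟨ cong₂ ℤ._+_ (ℤP.*-identityˡ a) (∑-const n (+ 0)) ⟩
    a ℤ.+ + n ℤ.* + 0
  ≡⟨ trans (cong (λ s → a ℤ.+ s) (ℤP.*-zeroʳ (+ n))) (ℤP.+-identityʳ a) ⟩
    a
  ∎
  where open ≡-Reasoning
∑-delta (suc n) (suc x) a = begin
    + ind (suc x ≟ zero) ℤ.* a ℤ.+ ∑[ v < n ] (+ ind (suc x ≟ suc v) ℤ.* a)
  ≡⟨ cong₂ ℤ._+_ (trans (cong (λ k → + k ℤ.* a) (ind-no (λ ()) (suc x ≟ zero))) (ℤP.*-zeroˡ a))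
                 (sum-cong-≗ {n} (λ v → cong (λ k → + k ℤ.* a)
                   (ind-⇔ suc-injective (cong suc) (suc x ≟ suc v) (x ≟ v)))) ⟩
    + 0 ℤ.+ ∑[ v < n ] (+ ind (x ≟ v) ℤ.* a)
  ≡⟨ trans (ℤP.+-identityˡ _) (∑-delta n x a) ⟩
    a
  ∎
  where open ≡-Reasoning

weightedFibre : ∀ {N m k} → (Fin m → Fin k → Fin N) → (Fin m → Fin k → ℤ) → Fin N → ℤ
weightedFibre {m = m} {k} h a v = sumℤ m (λ f → sumℤ k (λ j → + ind (h f j ≟ v) ℤ.* a f j))

fibre : ∀ {N m k} → (Fin m → Fin k → Fin N) → Fin N → ℕ
fibre {m = m} {k} h v = sumℕ m (λ f → sumℕ k (λ j → ind (h f j ≟ v)))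

-- Double counting: the fibres partition the domain, so the weighted fibre
-- sizes add up to the total weight.
∑-weightedFibre : ∀ N m k (h : Fin m → Fin k → Fin N) (a : Fin m → Fin k → ℤ) →
  ∑[ v < N ] weightedFibre h a v ≡ ∑[ f < m ] ∑[ j < k ] a f j
∑-weightedFibre N m k h a = begin
    ∑[ v < N ] weightedFibre h a v
  ≡⟨ sum-cong-≗ {N} (λ v → trans (sumℤ≡∑ m _) (sum-cong-≗ {m} (λ f → sumℤ≡∑ k _))) ⟩
    ∑[ v < N ] ∑[ f < m ] ∑[ j < k ] (+ ind (h f j ≟ v) ℤ.* a f j)
  ≡⟨ ∑-comm {N} {m} _ ⟩
    ∑[ f < m ] ∑[ v < N ] ∑[ j < k ] (+ ind (h f j ≟ v) ℤ.* a f j)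
  ≡⟨ sum-cong-≗ {m} (λ f → ∑-comm {N} {k} _) ⟩
    ∑[ f < m ] ∑[ j < k ] ∑[ v < N ] (+ ind (h f j ≟ v) ℤ.* a f j)
  ≡⟨ sum-cong-≗ {m} (λ f → sum-cong-≗ {k} (λ j → ∑-delta N (h f j) (a f j))) ⟩
    ∑[ f < m ] ∑[ j < k ] a f j
  ∎
  where open ≡-Reasoning

∑-fibre : ∀ N m k (h : Fin m → Fin k → Fin N) → ∑[ v < N ] (+ fibre h v) ≡ + m ℤ.* + k
∑-fibre N m k h = begin
    ∑[ v < N ] (+ fibre h v)
  ≡⟨ sum-cong-≗ {N} fibre≡weightedFibre ⟩
    ∑[ v < N ] weightedFibre h (λ _ _ → + 1) v
  ≡⟨ ∑-weightedFibre N m k h (λ _ _ → + 1) ⟩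
    ∑[ f < m ] ∑[ j < k ] (+ 1)
  ≡⟨ trans (sum-cong-≗ {m} (λ f → ∑-const k (+ 1))) (∑-const m _) ⟩
    + m ℤ.* (+ k ℤ.* + 1)
  ≡⟨ cong (+ m ℤ.*_) (ℤP.*-identityʳ (+ k)) ⟩
    + m ℤ.* + k
  ∎
  where
  open ≡-Reasoning
  fibre≡weightedFibre : ∀ v → + fibre h v ≡ weightedFibre h (λ _ _ → + 1) v
  fibre≡weightedFibre v = begin
      + fibre h v
    ≡⟨ trans (sumℕ≡∑ m _) (sum-cong-≗ {m} (λ f → sumℕ≡∑ k _)) ⟩
      ∑[ f < m ] ∑[ j < k ] (+ ind (h f j ≟ v))
    ≡⟨ sum-cong-≗ {m} (λ f → sum-cong-≗ {k} (λ j → sym (ℤP.*-identityʳ _))) ⟩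
      ∑[ f < m ] ∑[ j < k ] (+ ind (h f j ≟ v) ℤ.* + 1)
    ≡⟨ sym (trans (sumℤ≡∑ m _) (sum-cong-≗ {m} (λ f → sumℤ≡∑ k _))) ⟩
      weightedFibre h (λ _ _ → + 1) v
    ∎

/-distrib-+ : ∀ d a b → (a ℚ./ suc d) ℚ.+ (b ℚ./ suc d) ≡ (a ℤ.+ b) ℚ./ suc d
/-distrib-+ d a b = trans (sym (fromℚᵘ-toℚᵘ _)) (fromℚᵘ-cong {_} {mkℚᵘ (a ℤ.+ b) d}
  (≃-trans (toℚᵘ-homo-+ (a ℚ./ suc d) (b ℚ./ suc d))
  (≃-trans (ℚᵘP.+-cong (toℚᵘ-fromℚᵘ (mkℚᵘ a d)) (toℚᵘ-fromℚᵘ (mkℚᵘ b d)))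
    (*≡* (cross-multiplied a b (+ suc d))))))
  where
  cross-multiplied : ∀ a b d → (a ℤ.* d ℤ.+ b ℤ.* d) ℤ.* d ≡ (a ℤ.+ b) ℤ.* (d ℤ.* d)
  cross-multiplied = solve-∀

sumℚ-/ : ∀ d n (g : Fin n → ℤ) → sumℚ n (λ i → g i ℚ./ suc d) ≡ sumℤ n g ℚ./ suc d
sumℚ-/ d zero    g = sym (fromℚᵘ-cong {mkℚᵘ (+ 0) d} {mkℚᵘ (+ 0) 0} (*≡* refl))
sumℚ-/ d (suc n) g =
  trans (cong (λ s → (g zero ℚ./ suc d) ℚ.+ s) (sumℚ-/ d n (λ i → g (suc i))))
        (/-distrib-+ d (g zero) _)

*-/-cancel : ∀ d x → (+ suc d ℤ.* x) ℚ./ suc d ≡ x ℚ./ 1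
*-/-cancel d x = fromℚᵘ-cong {mkℚᵘ (+ suc d ℤ.* x) d} {mkℚᵘ x 0} (*≡* (cross-multiplied (+ suc d) x))
  where
  cross-multiplied : ∀ d x → (d ℤ.* x) ℤ.* + 1 ≡ x ℤ.* d
  cross-multiplied = solve-∀

module _ (S : WeakTropicalSurface) where
  open WeakTropicalSurface S
  open DeltaComplex2 complex

  -- Σ_v F_v = 3·#facets: the edges of the links are the corners of facets.
  ∑-linkEdges : ∑[ v < nV ] (+ linkEdges complex v) ≡ + nF ℤ.* + 3
  ∑-linkEdges = ∑-fibre nV nF 3 (facetVertex complex)

  -- Σ_v E_v = 2·#edges: the vertices of the links are the ends of edges.
  ∑-linkVertices : ∑[ v < nV ] (+ linkVertices complex v) ≡ + nE ℤ.* + 2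
  ∑-linkVertices = ∑-fibre nV nE 2 ep

  -- Σ_v Σ_{e∋v} α(v,e) = Σ_e deg e = 3·#facets, by the balancing
  -- condition α(v,e) + α(w,e) = deg e and since every facet has three sides.
  ∑-αSum : ∑[ v < nV ] αSum S v ≡ + nF ℤ.* + 3
  ∑-αSum = begin
      ∑[ v < nV ] αSum S v
    ≡⟨ ∑-weightedFibre nV nE 2 ep α ⟩
      ∑[ e < nE ] (α e zero ℤ.+ (α e (suc zero) ℤ.+ + 0))
    ≡⟨ sum-cong-≗ {nE} (λ e → trans (cong (λ s → α e zero ℤ.+ s) (ℤP.+-identityʳ _)) (α-deg e)) ⟩
      ∑[ e < nE ] (+ deg complex e)
    ≡⟨ ∑-fibre nE nF 3 bd ⟩
      + nF ℤ.* + 3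
    ∎
    where open ≡-Reasoning

  td2Numerator : Fin nV → ℤ
  td2Numerator v =
    ((+ 12 ℤ.+ + 5 ℤ.* + linkEdges complex v) ℤ.- + 6 ℤ.* + linkVertices complex v) ℤ.- αSum S v

  ∑-td2Numerator : ∑[ v < nV ] td2Numerator v ≡ + 12 ℤ.* euler complex
  ∑-td2Numerator = begin
      ∑[ v < nV ] td2Numerator v
    ≡⟨ ∑-affine nV (+ 12) (+ 5) (+ 6) _ _ (αSum S) ⟩
      ((+ nV ℤ.* + 12 ℤ.+ + 5 ℤ.* ∑[ v < nV ] (+ linkEdges complex v))
        ℤ.- + 6 ℤ.* ∑[ v < nV ] (+ linkVertices complex v)) ℤ.- ∑[ v < nV ] αSum S v
    ≡⟨ cong₂ ℤ._-_ (cong₂ (λ s t → (+ nV ℤ.* + 12 ℤ.+ + 5 ℤ.* s) ℤ.- + 6 ℤ.* t)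
                           ∑-linkEdges ∑-linkVertices) ∑-αSum ⟩
      ((+ nV ℤ.* + 12 ℤ.+ + 5 ℤ.* (+ nF ℤ.* + 3)) ℤ.- + 6 ℤ.* (+ nE ℤ.* + 2)) ℤ.- + nF ℤ.* + 3
    ≡⟨ regroup (+ nV) (+ nE) (+ nF) ⟩
      + 12 ℤ.* euler complex
    ∎
    where
    open ≡-Reasoning
    regroup : ∀ V E F → ((V ℤ.* + 12 ℤ.+ + 5 ℤ.* (F ℤ.* + 3)) ℤ.- + 6 ℤ.* (E ℤ.* + 2)) ℤ.- F ℤ.* + 3
                        ≡ + 12 ℤ.* ((V ℤ.- E) ℤ.+ F)
    regroup = solve-∀

proposition1p3 : (Δ : WeakTropicalSurface) → degTd2 Δ ≡ χ Δ
proposition1p3 Δ = begin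
    degTd2 Δ
  ≡⟨ sumℚ-/ 11 nV (td2Numerator Δ) ⟩
    sumℤ nV (td2Numerator Δ) ℚ./ 12
  ≡⟨ cong (ℚ._/ 12) (trans (sumℤ≡∑ nV _) (∑-td2Numerator Δ)) ⟩
    (+ 12 ℤ.* euler complex) ℚ./ 12
  ≡⟨ *-/-cancel 11 (euler complex) ⟩
    χ Δ
  ∎
  where
  open ≡-Reasoning
  open WeakTropicalSurface Δ using (complex)
  open DeltaComplex2 complex using (nV)
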